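{- For $n\ge1$, $c_{desc}(n)=\delta(n)$ (i.e. the descending ladder MinD tree on $n$ leaves has the minimum possible Colless index among full binary trees with $n$ leaves) if and only if $n=2^k$ for some $k\ge0$ or $n=2^{k+1}-2^j$ for some integers $0\le j\le k$. Moreover $c_{desc}(2^k)=0=\delta(2^k)$ and $c_{desc}(2^{k+1}-2^j)=2^j(k-j)=\delta(2^{k+1}-2^j)$.
   Context: Write $n=\sum_{i=1}^{\omega(n)}2^{\rho_i}$ with $\rho_{\omega(n)}>\dots>\rho_1\ge0$. A full binary tree is a rooted tree in which every node has $0$ or $2$ children; a ladder tree is one in which every internal node has at least one leaf child. A perfect binary tree with $2^j$ leaves has all leaves at depth $j$. The descending MinD tree on $n$ leaves is obtained from the ladder tree with $\omega(n)$ leaves by replacing its leaves with perfect trees so that the perfect tree with $2^{\rho_{\omega(n)}}$ leaves is a child of the root, then $2^{\rho_{\omega(n)-1}}$ on the next rung, and so on, with the perfect trees with $2^{\rho_2}$ and $2^{\rho_1}$ leaves as the two children of the lowest internal node of the ladder. $c_{desc}(n)$ is its Colless index, where the Colless index of a full binary tree is $\sum|\ell_L(v)-\ell_R(v)|$ over internal nodes $v$. $\delta(n)$ denotes the minimum Colless index over all full binary trees with $n$ leaves (equal to the Colless index, and to the number of internal nodes with unequal children leaf counts, of the divide-and-conquer tree, in which every internal node's two subtrees have leaf counts differing by at most $1$). -}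

module Defs where

open import Data.Nat using (ℕ; zero; suc; _+_; _*_; _^_; _≤_; _≟_; ∣_-_∣; _/_; _%_)
open import Data.List using (List; []; _∷_; reverse)
open import Data.Product using (Σ; _×_)
open import Relation.Binary.PropositionalEquality using (_≡_)
open import Relation.Nullary using (yes; no)

data Tree : Set where
  leaf : Tree
  node : Tree → Tree → Tree

leaves : Tree → ℕ
leaves leaf       = 1
leaves (node l r) = leaves l + leaves r

colless : Tree → ℕ
colless leaf       = 0
colless (node l r) = ∣ leaves l - leaves r ∣ + colless l + colless r

perfect : ℕ → Tree
perfect zero    = leaf
perfect (suc j) = node (perfect j) (perfect j)

-- exponents of the binary expansion, ascending: digitsAux fuel p n lists
-- p + (positions of the 1-bits of n); fuel n suffices.
digitsAux : ℕ → ℕ → ℕ → List ℕ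
digitsAux zero    p n = []
digitsAux (suc f) p n with n ≟ 0
... | yes _ = []
... | no  _ with n % 2
...   | zero  = digitsAux f (suc p) (n / 2)
...   | suc _ = p ∷ digitsAux f (suc p) (n / 2)

binExps : ℕ → List ℕ
binExps n = digitsAux n 0 n

-- ladder with perfect trees hanging off, given the exponents in DESCENDING order:
-- root has child perfect(ρ_ω) and the rest of the ladder; the lowest internal node
-- has the two children perfect(ρ_2), perfect(ρ_1).  (Empty list only for n = 0; irrelevant.)
ladderDesc : List ℕ → Tree
ladderDesc []           = leaf
ladderDesc (r ∷ [])     = perfect r
ladderDesc (r ∷ s ∷ rs) = node (perfect r) (ladderDesc (s ∷ rs))

descMinD : ℕ → Tree
descMinD n = ladderDesc (reverse (binExps n))

cdesc : ℕ → ℕ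
cdesc n = colless (descMinD n)

-- "m = δ(n)": m is the minimum Colless index over all full binary trees with n leaves
-- (attained by some tree with n leaves, and a lower bound for all of them).
IsMinColless : ℕ → ℕ → Set
IsMinColless n m =
  Σ Tree (λ t → leaves t ≡ n × colless t ≡ m) × ((t : Tree) → leaves t ≡ n → m ≤ colless t)

{-# OPTIONS --safe #-}
-- δ n, the Colless index of the divide-and-conquer tree, satisfies δ (2m) = 2 δ m and
-- δ (2m + 1) = 1 + δ m + δ (m + 1) for m ≥ 1. A strong induction through the four parity
-- cases gives δ (a + b) ≤ ∣ a - b ∣ + δ a + δ b, hence δ (leaves t) ≤ colless t for every
-- tree t. For n = 2^p (2^(m+1) - 1) the binary exponents are p, …, p + m, the descending
-- ladder costs 2^p m and δ n = 2^p m, so that ladder is optimal. Conversely, if consecutive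
-- rungs of an optimal descending ladder carried exponents r > s + 1, the subtree T below the
-- perfect tree with 2^r leaves would have fewer than 2^(r-1) leaves, and replacing
-- node (perfect r) T by node (node (perfect (r-1)) T) (perfect (r-1)) would strictly lower the
-- Colless index. Optimality passes to sub-ladders, so all exponents are consecutive.
module Submission where

open import Defs
open import Data.Nat
open import Data.Nat.Properties
open import Data.Nat.DivMod
open import Data.Nat.Induction using (<-rec; <-wellFounded)
open import Data.Nat.ListAction using (sum)
open import Data.Nat.ListAction.Properties using (sum-↭)
open import Data.Nat.Tactic.RingSolver using (solve-∀)
open import Data.List using (List; []; _∷_; map; reverse; _ʳ++_; _++_)
open import Data.List.Properties using (++-identityʳ)
open import Data.List.Relation.Unary.Linked using (Linked; []; [-]; _∷_)
open import Data.List.Relation.Binary.Permutation.Propositional.Properties using (map⁺; ↭-reverse)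
open import Data.Product using (Σ; ∃₂; _×_; _,_)
open import Data.Sum using (_⊎_; inj₁; inj₂)
open import Function.Base using (_∘_; flip)
open import Function.Bundles using (_⇔_; mk⇔)
open import Function.Construct.Composition using (_⇔-∘_)
open import Induction.WellFounded using (WfRec; module FixPoint)
open import Relation.Binary.PropositionalEquality
open import Relation.Nullary using (yes; no; contradiction)

-- The minimal Colless index

data EvenOdd : ℕ → Set where
  even : ∀ m → EvenOdd (m + m)
  odd  : ∀ m → EvenOdd (suc (m + m))

evenOdd : ∀ n → EvenOdd n
evenOdd zero = even 0
evenOdd (suc n) with evenOdd n
... | even m = odd m
... | odd m  = subst EvenOdd (cong suc (+-suc m m)) (even (suc m))

δ-step : ∀ n → WfRec _<_ (λ _ → ℕ) n → ℕ
δ-step 0 _ = 0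
δ-step 1 _ = 0
δ-step (suc (suc n)) δ< =
  ∣ ⌊ 2 + n /2⌋ - ⌈ 2 + n /2⌉ ∣ + δ< (⌊n/2⌋<n (suc n)) + δ< (⌈n/2⌉<n n)

δ : ℕ → ℕ
δ = <-rec (λ _ → ℕ) δ-step

δ-halves : ∀ {n a b} → 2 ≤ n → ⌊ n /2⌋ ≡ a → ⌈ n /2⌉ ≡ b → δ n ≡ ∣ a - b ∣ + δ a + δ b
δ-halves {suc (suc n)} (s≤s (s≤s _)) refl refl =
  FixPoint.unfold-wfRec <-wellFounded (λ _ → ℕ) δ-step step-ext {suc (suc n)}
  where
  step-ext : ∀ n {δ< δ<′ : WfRec _<_ (λ _ → ℕ) n} → (∀ {m} (m<n : m < n) → δ< m<n ≡ δ<′ m<n) →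
             δ-step n δ< ≡ δ-step n δ<′
  step-ext 0 _ = refl
  step-ext 1 _ = refl
  step-ext (suc (suc n)) eq = cong₂ (λ a b → ∣ ⌊ 2 + n /2⌋ - ⌈ 2 + n /2⌉ ∣ + a + b) (eq _) (eq _)

∣n-1+n∣≡1 : ∀ n → ∣ n - suc n ∣ ≡ 1
∣n-1+n∣≡1 zero    = refl
∣n-1+n∣≡1 (suc n) = ∣n-1+n∣≡1 n

δ-double : ∀ m → δ (m + m) ≡ δ m + δ m
δ-double zero = refl
δ-double m@(suc _) =
  trans (δ-halves (+-mono-≤ (s≤s z≤n) (s≤s z≤n)) (sym (n≡⌊n+n/2⌋ m)) (sym (n≡⌈n+n/2⌉ m)))
        (cong (λ c → c + δ m + δ m) (∣n-n∣≡0 m))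

δ-double+1 : ∀ m → 1 ≤ m → δ (suc (m + m)) ≡ 1 + δ m + δ (suc m)
δ-double+1 m 1≤m =
  trans (δ-halves (s≤s (≤-trans 1≤m (m≤m+n m m))) (sym (n≡⌈n+n/2⌉ m)) (cong suc (sym (n≡⌊n+n/2⌋ m))))
        (cong (λ c → c + δ m + δ (suc m)) (∣n-1+n∣≡1 m))

-- The case a = 1 of δ-split-≤, where δ-double+1 does not apply because δ 1 = 0.
δ-suc-suc-≤ : ∀ d → δ (2 + d) ≤ d + δ (1 + d)
δ-suc-suc-≤ = <-rec _ go
  where
  open ≤-Reasoning
  go : ∀ d → WfRec _<_ (λ d → δ (2 + d) ≤ d + δ (1 + d)) d → δ (2 + d) ≤ d + δ (1 + d)
  go d IH with evenOdd d
  ... | even zero = z≤n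
  ... | even y@(suc e) = begin
    δ (2 + (y + y))                 ≡⟨ cong (δ ∘ suc) (sym (+-suc y y)) ⟩
    δ (suc y + suc y)               ≡⟨ δ-double (suc y) ⟩
    δ (suc y) + δ (suc y)           ≤⟨ +-monoʳ-≤ (δ (suc y)) (IH (m≤m+n (suc e) (suc e))) ⟩
    δ (suc y) + (e + δ y)           ≤⟨ m≤n+m _ (3 + e) ⟩
    3 + e + (δ (suc y) + (e + δ y)) ≡⟨ regroup (δ y) (δ (suc y)) e ⟩
    y + y + (1 + δ y + δ (suc y))   ≡⟨ cong (y + y +_) (sym (δ-double+1 y (s≤s z≤n))) ⟩
    y + y + δ (1 + (y + y))         ∎
    where
    regroup : ∀ a b e → 3 + e + (b + (e + a)) ≡ suc e + suc e + (1 + a + b)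
    regroup = solve-∀
  ... | odd y = begin
    δ (2 + suc (y + y))                   ≡⟨ cong (δ ∘ suc ∘ suc) (sym (+-suc y y)) ⟩
    δ (suc (suc y + suc y))               ≡⟨ δ-double+1 (suc y) (s≤s z≤n) ⟩
    1 + δ (suc y) + δ (2 + y)             ≤⟨ +-monoʳ-≤ (1 + δ (suc y)) (IH (s≤s (m≤m+n y y))) ⟩
    1 + δ (suc y) + (y + δ (suc y))       ≤⟨ m≤n+m _ y ⟩
    y + (1 + δ (suc y) + (y + δ (suc y))) ≡⟨ regroup (δ (suc y)) y ⟩
    suc (y + y) + (δ (suc y) + δ (suc y)) ≡⟨ cong (suc (y + y) +_) (sym (δ-double (suc y))) ⟩
    suc (y + y) + δ (suc y + suc y)       ≡⟨ cong (λ n → suc (y + y) + δ (suc n)) (+-suc y y) ⟩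
    suc (y + y) + δ (1 + suc (y + y))     ∎
    where
    regroup : ∀ b y → y + (1 + b + (y + b)) ≡ suc (y + y) + (b + b)
    regroup = solve-∀

SplitBound : ℕ → ℕ → Set
SplitBound a d = δ (a + (a + d)) ≤ d + δ a + δ (a + d)

split-even-even : ∀ x y → (∀ d → SplitBound x d) → SplitBound (x + x) (y + y)
split-even-even x y ih = begin
  δ ((x + x) + ((x + x) + (y + y)))                   ≡⟨ cong δ (shape₁ x y) ⟩
  δ (x + (x + y) + (x + (x + y)))                     ≡⟨ δ-double (x + (x + y)) ⟩
  δ (x + (x + y)) + δ (x + (x + y))                   ≤⟨ +-mono-≤ (ih y) (ih y) ⟩
  (y + δ x + δ (x + y)) + (y + δ x + δ (x + y))       ≡⟨ regroup y (δ x) (δ (x + y)) ⟩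
  (y + y) + (δ x + δ x) + (δ (x + y) + δ (x + y))     ≡⟨ cong₂ (λ p q → y + y + p + q) (sym (δ-double x)) (sym (δ-double (x + y))) ⟩
  (y + y) + δ (x + x) + δ ((x + y) + (x + y))         ≡⟨ cong (λ n → y + y + δ (x + x) + δ n) (shape₂ x y) ⟩
  (y + y) + δ (x + x) + δ ((x + x) + (y + y))         ∎
  where
  open ≤-Reasoning
  shape₁ : ∀ x y → (x + x) + ((x + x) + (y + y)) ≡ x + (x + y) + (x + (x + y))
  shape₁ = solve-∀
  shape₂ : ∀ x y → (x + y) + (x + y) ≡ (x + x) + (y + y)
  shape₂ = solve-∀
  regroup : ∀ y p q → (y + p + q) + (y + p + q) ≡ (y + y) + (p + p) + (q + q)
  regroup = solve-∀

split-even-odd : ∀ x y → 1 ≤ x → (∀ d → SplitBound x d) → SplitBound (x + x) (suc (y + y))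
split-even-odd x y 1≤x ih = begin
  δ ((x + x) + ((x + x) + suc (y + y)))               ≡⟨ cong δ (shape₁ x y) ⟩
  δ (suc (m + m))                                     ≡⟨ δ-double+1 m (≤-trans 1≤x (m≤m+n x _)) ⟩
  1 + δ m + δ (suc m)                                 ≡⟨ cong (λ n → 1 + δ m + δ n) (shape₂ x y) ⟩
  1 + δ m + δ (x + (x + suc y))                       ≤⟨ +-mono-≤ (+-monoʳ-≤ 1 (ih y)) (ih (suc y)) ⟩
  1 + (y + δ x + δ (x + y)) + (suc y + δ x + δ (x + suc y))
                                                      ≡⟨ cong (λ n → 1 + (y + δ x + δ (x + y)) + (suc y + δ x + δ n)) (+-suc x y) ⟩
  1 + (y + δ x + δ (x + y)) + (suc y + δ x + δ (suc (x + y)))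
                                                      ≡⟨ regroup y (δ x) (δ (x + y)) (δ (suc (x + y))) ⟩
  suc (y + y) + (δ x + δ x) + (1 + δ (x + y) + δ (suc (x + y)))
                                                      ≡⟨ cong₂ (λ p q → suc (y + y) + p + q) (sym (δ-double x))
                                                               (sym (δ-double+1 (x + y) (≤-trans 1≤x (m≤m+n x y)))) ⟩
  suc (y + y) + δ (x + x) + δ (suc ((x + y) + (x + y))) ≡⟨ cong (λ n → suc (y + y) + δ (x + x) + δ n) (shape₃ x y) ⟩
  suc (y + y) + δ (x + x) + δ ((x + x) + suc (y + y)) ∎
  where
  open ≤-Reasoning
  m = x + (x + y)
  shape₁ : ∀ x y → (x + x) + ((x + x) + suc (y + y)) ≡ suc (x + (x + y) + (x + (x + y)))
  shape₁ = solve-∀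
  shape₂ : ∀ x y → suc (x + (x + y)) ≡ x + (x + suc y)
  shape₂ = solve-∀
  shape₃ : ∀ x y → suc ((x + y) + (x + y)) ≡ (x + x) + suc (y + y)
  shape₃ = solve-∀
  regroup : ∀ y p q r → 1 + (y + p + q) + (suc y + p + r) ≡ suc (y + y) + (p + p) + (1 + q + r)
  regroup = solve-∀

split-odd-even : ∀ x e → 1 ≤ x → (∀ d → SplitBound x d) → (∀ d → SplitBound (suc x) d) →
  SplitBound (suc (x + x)) (suc e + suc e)
split-odd-even x e 1≤x ih ih′ = begin
  δ (suc (x + x) + (suc (x + x) + (y + y)))           ≡⟨ cong δ (shape₁ x e) ⟩
  δ (M + M)                                           ≡⟨ δ-double M ⟩
  δ M + δ M                                           ≡⟨ cong₂ (λ p q → δ p + δ q) (shape₂ x e) (shape₃ x e) ⟩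
  δ (x + (x + suc y)) + δ (suc x + (suc x + e))       ≤⟨ +-mono-≤ (ih (suc y)) (ih′ e) ⟩
  (suc y + δ x + δ (x + suc y)) + (e + δ (suc x) + δ (suc x + e))
                                                      ≡⟨ cong₂ (λ p q → (suc y + δ x + δ p) + (e + δ (suc x) + δ q)) (shape₄ x e) (shape₅ x e) ⟩
  (suc y + δ x + δ (suc (x + y))) + (e + δ (suc x) + δ (x + y))
                                                      ≤⟨ m≤n+m _ 2 ⟩
  2 + ((suc y + δ x + δ (suc (x + y))) + (e + δ (suc x) + δ (x + y)))
                                                      ≡⟨ regroup e (δ x) (δ (suc x)) (δ (x + y)) (δ (suc (x + y))) ⟩
  (y + y) + (1 + δ x + δ (suc x)) + (1 + δ (x + y) + δ (suc (x + y)))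
                                                      ≡⟨ cong₂ (λ p q → y + y + p + q) (sym (δ-double+1 x 1≤x))
                                                               (sym (δ-double+1 (x + y) (≤-trans 1≤x (m≤m+n x y)))) ⟩
  (y + y) + δ (suc (x + x)) + δ (suc ((x + y) + (x + y))) ≡⟨ cong (λ n → y + y + δ (suc (x + x)) + δ n) (shape₆ x y) ⟩
  (y + y) + δ (suc (x + x)) + δ (suc (x + x) + (y + y)) ∎
  where
  open ≤-Reasoning
  y = suc e
  M = suc (x + (x + y))
  shape₁ : ∀ x e → suc (x + x) + (suc (x + x) + (suc e + suc e)) ≡ suc (x + (x + suc e)) + suc (x + (x + suc e))
  shape₁ = solve-∀
  shape₂ : ∀ x e → suc (x + (x + suc e)) ≡ x + (x + suc (suc e))
  shape₂ = solve-∀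
  shape₃ : ∀ x e → suc (x + (x + suc e)) ≡ suc x + (suc x + e)
  shape₃ = solve-∀
  shape₄ : ∀ x e → x + suc (suc e) ≡ suc (x + suc e)
  shape₄ = solve-∀
  shape₅ : ∀ x e → suc x + e ≡ x + suc e
  shape₅ = solve-∀
  shape₆ : ∀ x y → suc ((x + y) + (x + y)) ≡ suc (x + x) + (y + y)
  shape₆ = solve-∀
  regroup : ∀ e p p′ q q′ → 2 + ((suc (suc e) + p + q′) + (e + p′ + q)) ≡ (suc e + suc e) + (1 + p + p′) + (1 + q + q′)
  regroup = solve-∀

split-odd-odd : ∀ x y → 1 ≤ x → (∀ d → SplitBound x d) → (∀ d → SplitBound (suc x) d) →
  SplitBound (suc (x + x)) (suc (y + y))
split-odd-odd x y 1≤x ih ih′ = begin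
  δ (suc (x + x) + (suc (x + x) + suc (y + y)))       ≡⟨ cong δ (shape₁ x y) ⟩
  δ (suc (m + m))                                     ≡⟨ δ-double+1 m (s≤s z≤n) ⟩
  1 + δ m + δ (suc m)                                 ≡⟨ cong₂ (λ p q → 1 + δ p + δ q) (shape₂ x y) (shape₃ x y) ⟩
  1 + δ (x + (x + suc y)) + δ (suc x + (suc x + y))   ≤⟨ +-mono-≤ (+-monoʳ-≤ 1 (ih (suc y))) (ih′ y) ⟩
  1 + (suc y + δ x + δ (x + suc y)) + (y + δ (suc x) + δ (suc x + y))
                                                      ≡⟨ cong (λ p → 1 + (suc y + δ x + δ p) + (y + δ (suc x) + δ (suc x + y))) (+-suc x y) ⟩
  1 + (suc y + δ x + δ B) + (y + δ (suc x) + δ B)     ≡⟨ regroup y (δ x) (δ (suc x)) (δ B) ⟩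
  suc (y + y) + (1 + δ x + δ (suc x)) + (δ B + δ B)   ≡⟨ cong₂ (λ p q → suc (y + y) + p + q) (sym (δ-double+1 x 1≤x)) (sym (δ-double B)) ⟩
  suc (y + y) + δ (suc (x + x)) + δ (B + B)           ≡⟨ cong (λ n → suc (y + y) + δ (suc (x + x)) + δ n) (shape₄ x y) ⟩
  suc (y + y) + δ (suc (x + x)) + δ (suc (x + x) + suc (y + y)) ∎
  where
  open ≤-Reasoning
  m = suc (x + (x + y))
  B = suc (x + y)
  shape₁ : ∀ x y → suc (x + x) + (suc (x + x) + suc (y + y)) ≡ suc (suc (x + (x + y)) + suc (x + (x + y)))
  shape₁ = solve-∀
  shape₂ : ∀ x y → suc (x + (x + y)) ≡ x + (x + suc y)
  shape₂ = solve-∀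
  shape₃ : ∀ x y → suc (suc (x + (x + y))) ≡ suc x + (suc x + y)
  shape₃ = solve-∀
  shape₄ : ∀ x y → suc (x + y) + suc (x + y) ≡ suc (x + x) + suc (y + y)
  shape₄ = solve-∀
  regroup : ∀ y p p′ q → 1 + (suc y + p + q) + (y + p′ + q) ≡ suc (y + y) + (1 + p + p′) + (q + q)
  regroup = solve-∀

split-zero : ∀ a → SplitBound a 0
split-zero a rewrite +-identityʳ a = ≤-reflexive (δ-double a)

δ-split-≤ : ∀ a d → SplitBound a d
δ-split-≤ = <-rec (λ a → ∀ d → SplitBound a d) go
  where
  go : ∀ a → WfRec _<_ (λ a → ∀ d → SplitBound a d) a → ∀ d → SplitBound a d
  go a IH d with evenOdd a | evenOdd d
  ... | even zero | _ = m≤n+m (δ d) (d + 0)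
  ... | odd zero  | _ = ≤-trans (δ-suc-suc-≤ d) (≤-reflexive (cong (_+ δ (1 + d)) (sym (+-identityʳ d))))
  ... | even x@(suc _) | even y = split-even-even x y (IH (m<m+n x z<s))
  ... | even x@(suc _) | odd y  = split-even-odd x y z<s (IH (m<m+n x z<s))
  ... | odd (suc _)    | even zero = split-zero a
  ... | odd x@(suc _)  | even (suc e) =
    split-odd-even x e z<s (IH (s≤s (m≤m+n x x))) (IH (s<s (m<m+n x z<s)))
  ... | odd x@(suc _)  | odd y =
    split-odd-odd x y z<s (IH (s≤s (m≤m+n x x))) (IH (s<s (m<m+n x z<s)))

δ-+-≤-ordered : ∀ {a b} → a ≤ b → δ (a + b) ≤ ∣ a - b ∣ + δ a + δ b
δ-+-≤-ordered {a} a≤b with d , refl ← m≤n⇒∃[o]m+o≡n a≤b rewrite ∣m-m+n∣≡n a d = δ-split-≤ a d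

δ-+-≤ : ∀ a b → δ (a + b) ≤ ∣ a - b ∣ + δ a + δ b
δ-+-≤ a b with ≤-total a b
... | inj₁ a≤b = δ-+-≤-ordered a≤b
... | inj₂ b≤a = begin
  δ (a + b)               ≡⟨ cong δ (+-comm a b) ⟩
  δ (b + a)               ≤⟨ δ-+-≤-ordered b≤a ⟩
  ∣ b - a ∣ + δ b + δ a   ≡⟨ swap ∣ b - a ∣ (δ b) (δ a) ⟩
  ∣ b - a ∣ + δ a + δ b   ≡⟨ cong (λ c → c + δ a + δ b) (∣-∣-comm b a) ⟩
  ∣ a - b ∣ + δ a + δ b   ∎
  where
  open ≤-Reasoning
  swap : ∀ c p q → c + p + q ≡ c + q + p
  swap = solve-∀

δ-≤-colless : ∀ t → δ (leaves t) ≤ colless t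
δ-≤-colless leaf       = z≤n
δ-≤-colless (node l r) = begin
  δ (leaves l + leaves r)                              ≤⟨ δ-+-≤ (leaves l) (leaves r) ⟩
  ∣ leaves l - leaves r ∣ + δ (leaves l) + δ (leaves r) ≤⟨ +-mono-≤ (+-monoʳ-≤ ∣ leaves l - leaves r ∣ (δ-≤-colless l)) (δ-≤-colless r) ⟩
  ∣ leaves l - leaves r ∣ + colless l + colless r       ∎
  where open ≤-Reasoning

δ-2^* : ∀ j y → δ (2 ^ j * y) ≡ 2 ^ j * δ y
δ-2^* zero    y = trans (cong δ (*-identityˡ y)) (sym (*-identityˡ (δ y)))
δ-2^* (suc j) y = begin
  δ (2 ^ suc j * y)                    ≡⟨ cong δ (double (2 ^ j) y) ⟩
  δ (2 ^ j * y + 2 ^ j * y)            ≡⟨ δ-double (2 ^ j * y) ⟩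
  δ (2 ^ j * y) + δ (2 ^ j * y)        ≡⟨ cong (λ d → d + d) (δ-2^* j y) ⟩
  2 ^ j * δ y + 2 ^ j * δ y            ≡⟨ sym (double (2 ^ j) (δ y)) ⟩
  2 ^ suc j * δ y                      ∎
  where
  open ≡-Reasoning
  double : ∀ a y → 2 * a * y ≡ a * y + a * y
  double = solve-∀

δ-2^ : ∀ j → δ (2 ^ j) ≡ 0
δ-2^ j = begin
  δ (2 ^ j)         ≡⟨ cong δ (sym (*-identityʳ (2 ^ j))) ⟩
  δ (2 ^ j * 1)     ≡⟨ δ-2^* j 1 ⟩
  2 ^ j * 0         ≡⟨ *-zeroʳ (2 ^ j) ⟩
  0                 ∎
  where open ≡-Reasoning

-- Binary expansions

binValue : List ℕ → ℕ
binValue = sum ∘ map (2 ^_)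

binValue-reverse : ∀ xs → binValue (reverse xs) ≡ binValue xs
binValue-reverse xs = sum-↭ (map⁺ (2 ^_) (↭-reverse xs))

n≤1+f⇒n/2≤f : ∀ {n f} → n ≢ 0 → n ≤ suc f → n / 2 ≤ f
n≤1+f⇒n/2≤f {n} n≢0 n≤1+f = ≤-pred (≤-trans (m/n<m n 2 {{≢-nonZero n≢0}} (s≤s (s≤s z≤n))) n≤1+f)

binValue-digitsAux : ∀ f p n → n ≤ f → binValue (digitsAux f p n) ≡ 2 ^ p * n
binValue-digitsAux zero p zero z≤n = sym (*-zeroʳ (2 ^ p))
binValue-digitsAux (suc f) p n n≤1+f with n ≟ 0
... | yes refl = sym (*-zeroʳ (2 ^ p))
... | no n≢0 with n % 2 | m≡m%n+[m/n]*n n 2 | m%n<n n 2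
...   | 0 | n≡ | _ = begin
  binValue (digitsAux f (suc p) (n / 2)) ≡⟨ binValue-digitsAux f (suc p) (n / 2) (n≤1+f⇒n/2≤f n≢0 n≤1+f) ⟩
  2 * 2 ^ p * (n / 2)                    ≡⟨ regroup (2 ^ p) (n / 2) ⟩
  2 ^ p * (n / 2 * 2)                    ≡⟨ cong (2 ^ p *_) (sym n≡) ⟩
  2 ^ p * n                              ∎
  where
  open ≡-Reasoning
  regroup : ∀ a b → 2 * a * b ≡ a * (b * 2)
  regroup = solve-∀
...   | 1 | n≡ | _ = begin
  2 ^ p + binValue (digitsAux f (suc p) (n / 2)) ≡⟨ cong (2 ^ p +_) (binValue-digitsAux f (suc p) (n / 2) (n≤1+f⇒n/2≤f n≢0 n≤1+f)) ⟩
  2 ^ p + 2 * 2 ^ p * (n / 2)                    ≡⟨ regroup (2 ^ p) (n / 2) ⟩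
  2 ^ p * (1 + n / 2 * 2)                        ≡⟨ cong (2 ^ p *_) (sym n≡) ⟩
  2 ^ p * n                                      ∎
  where
  open ≡-Reasoning
  regroup : ∀ a b → a + 2 * a * b ≡ a * (1 + b * 2)
  regroup = solve-∀
...   | suc (suc _) | _ | s≤s (s≤s ())

binValue-binExps : ∀ n → binValue (binExps n) ≡ n
binValue-binExps n = trans (binValue-digitsAux n 0 n ≤-refl) (*-identityˡ n)

digitsAux-above : ∀ f {q p} n → q < p → Linked _<_ (q ∷ digitsAux f p n)
digitsAux-above zero n q<p = [-]
digitsAux-above (suc f) {p = p} n q<p with n ≟ 0
... | yes _ = [-]
... | no _ with n % 2
...   | zero  = digitsAux-above f (n / 2) (m<n⇒m<1+n q<p)
...   | suc _ = q<p ∷ digitsAux-above f (n / 2) (n<1+n p)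

digitsAux-ascending : ∀ f p n → Linked _<_ (digitsAux f p n)
digitsAux-ascending zero p n = []
digitsAux-ascending (suc f) p n with n ≟ 0
... | yes _ = []
... | no _ with n % 2
...   | zero  = digitsAux-ascending f (suc p) (n / 2)
...   | suc _ = digitsAux-above f (n / 2) (n<1+n p)

Linked-reverse : ∀ {A : Set} {R : A → A → Set} {xs} → Linked R xs → Linked (flip R) (reverse xs)
Linked-reverse []                    = []
Linked-reverse [-]                   = [-]
Linked-reverse {R = R} (Rxy ∷ Rys) = go Rys (Rxy ∷ [-])
  where
  go : ∀ {x xs acc} → Linked R (x ∷ xs) → Linked (flip R) (x ∷ acc) → Linked (flip R) (xs ʳ++ x ∷ acc)
  go [-]         acc = acc
  go (Rxy ∷ Rys) acc = go Rys (Rxy ∷ acc)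

-- ones m = 2 ^ (m + 1) ∸ 1, whose binary expansion consists of m + 1 ones.
ones : ℕ → ℕ
ones zero    = 1
ones (suc m) = suc (ones m + ones m)

upFrom : ℕ → ℕ → List ℕ
upFrom p zero    = p ∷ []
upFrom p (suc m) = p ∷ upFrom (suc p) m

downTo : ℕ → ℕ → List ℕ
downTo p zero    = p ∷ []
downTo p (suc m) = suc m + p ∷ downTo p m

x+x≡x*2 : ∀ x → x + x ≡ x * 2
x+x≡x*2 = solve-∀

[x+x]%2≡0 : ∀ x → (x + x) % 2 ≡ 0
[x+x]%2≡0 x = trans (%-congˡ {o = 2} (x+x≡x*2 x)) (m*n%n≡0 x 2)

[x+x]/2≡x : ∀ x → (x + x) / 2 ≡ x
[x+x]/2≡x x = trans (/-congˡ {o = 2} (x+x≡x*2 x)) (m*n/n≡m x 2)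

[1+x+x]%2≡1 : ∀ x → suc (x + x) % 2 ≡ 1
[1+x+x]%2≡1 x = trans (%-congˡ {o = 2} (cong suc (x+x≡x*2 x))) ([m+kn]%n≡m%n 1 x 2)

[1+x+x]/2≡x : ∀ x → suc (x + x) / 2 ≡ x
[1+x+x]/2≡x x = begin
  suc (x + x) / 2       ≡⟨ /-congˡ {o = 2} (cong suc (x+x≡x*2 x)) ⟩
  (1 + x * 2) / 2       ≡⟨ +-distrib-/ 1 (x * 2) {2} (subst (λ r → 1 + r < 2) (sym (m*n%n≡0 x 2)) ≤-refl) ⟩
  1 / 2 + x * 2 / 2     ≡⟨ cong (1 / 2 +_) (m*n/n≡m x 2) ⟩
  x                     ∎
  where open ≡-Reasoning

digitsAux-double : ∀ f p x → x ≢ 0 → digitsAux (suc f) p (x + x) ≡ digitsAux f (suc p) x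
digitsAux-double f p x x≢0 with x + x ≟ 0
... | yes x+x≡0 = contradiction (m+n≡0⇒m≡0 x x+x≡0) x≢0
... | no _ rewrite [x+x]%2≡0 x | [x+x]/2≡x x = refl

digitsAux-double+1 : ∀ f p x → digitsAux (suc f) p (suc (x + x)) ≡ p ∷ digitsAux f (suc p) x
digitsAux-double+1 f p x rewrite [1+x+x]%2≡1 x | [1+x+x]/2≡x x = refl

digitsAux-zero : ∀ f p → digitsAux f p 0 ≡ []
digitsAux-zero zero    p = refl
digitsAux-zero (suc f) p = refl

ones>0 : ∀ m → 1 ≤ ones m
ones>0 zero    = s≤s z≤n
ones>0 (suc m) = s≤s z≤n

digitsAux-ones : ∀ f p m → ones m ≤ f → digitsAux f p (ones m) ≡ upFrom p m
digitsAux-ones (suc f) p zero    _ = cong (p ∷_) (digitsAux-zero f (suc p))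
digitsAux-ones (suc f) p (suc m) (s≤s o+o≤f) =
  trans (digitsAux-double+1 f p (ones m)) (cong (p ∷_) (digitsAux-ones f (suc p) m (≤-trans (m≤m+n _ _) o+o≤f)))

digitsAux-2^*ones : ∀ j f p m → 2 ^ j * ones m ≤ f → digitsAux f p (2 ^ j * ones m) ≡ upFrom (j + p) m
digitsAux-2^*ones zero f p m le rewrite *-identityˡ (ones m) = digitsAux-ones f p m le
digitsAux-2^*ones (suc j) f p m le =
  trans (cong (digitsAux f p) 2^[1+j]*o≡x+x) (halve f (subst (_≤ f) 2^[1+j]*o≡x+x le))
  where
  x = 2 ^ j * ones m
  1≤x : 1 ≤ x
  1≤x = *-mono-≤ (m^n>0 2 j) (ones>0 m)
  2^[1+j]*o≡x+x : 2 ^ suc j * ones m ≡ x + x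
  2^[1+j]*o≡x+x = double (2 ^ j) (ones m)
    where double : ∀ a b → 2 * a * b ≡ a * b + a * b
          double = solve-∀
  halve : ∀ f → x + x ≤ f → digitsAux f p (x + x) ≡ upFrom (suc j + p) m
  halve zero x+x≤0 = contradiction (≤-trans (+-mono-≤ 1≤x 1≤x) x+x≤0) λ ()
  halve (suc f) x+x≤1+f = begin
    digitsAux (suc f) p (x + x)   ≡⟨ digitsAux-double f p x (m<n⇒n≢0 1≤x) ⟩
    digitsAux f (suc p) x         ≡⟨ digitsAux-2^*ones j f (suc p) m x≤f ⟩
    upFrom (j + suc p) m          ≡⟨ cong (λ q → upFrom q m) (+-suc j p) ⟩
    upFrom (suc j + p) m          ∎
    where
    open ≡-Reasoning
    x≤f = ≤-pred (≤-trans (+-monoˡ-≤ x 1≤x) x+x≤1+f)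

reverse-upFrom : ∀ p m → reverse (upFrom p m) ≡ downTo p m
reverse-upFrom p m = trans (go p m []) (++-identityʳ (downTo p m))
  where
  downTo-∷ʳ : ∀ p m acc → downTo (suc p) m ++ p ∷ acc ≡ downTo p (suc m) ++ acc
  downTo-∷ʳ p zero    acc = refl
  downTo-∷ʳ p (suc m) acc = cong₂ _∷_ (+-suc (suc m) p) (downTo-∷ʳ p m acc)
  go : ∀ p m acc → upFrom p m ʳ++ acc ≡ downTo p m ++ acc
  go p zero    acc = refl
  go p (suc m) acc = trans (go (suc p) m (p ∷ acc)) (downTo-∷ʳ p m acc)

-- Ladders with consecutive exponents

leaves-perfect : ∀ r → leaves (perfect r) ≡ 2 ^ r
leaves-perfect zero    = refl
leaves-perfect (suc r) = cong₂ _+_ (leaves-perfect r) (trans (leaves-perfect r) (sym (+-identityʳ (2 ^ r))))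

colless-perfect : ∀ r → colless (perfect r) ≡ 0
colless-perfect zero    = refl
colless-perfect (suc r) rewrite ∣n-n∣≡0 (leaves (perfect r)) | colless-perfect r = refl

leaves-ladderDesc : ∀ ds → 1 ≤ binValue ds → leaves (ladderDesc ds) ≡ binValue ds
leaves-ladderDesc (r ∷ [])     _ = trans (leaves-perfect r) (sym (+-identityʳ (2 ^ r)))
leaves-ladderDesc (r ∷ s ∷ rs) _ = cong₂ _+_ (leaves-perfect r) (leaves-ladderDesc (s ∷ rs) (≤-trans (m^n>0 2 s) (m≤m+n _ _)))

ladderDesc-∷-downTo : ∀ r p m → ladderDesc (r ∷ downTo p m) ≡ node (perfect r) (ladderDesc (downTo p m))
ladderDesc-∷-downTo r p zero    = refl
ladderDesc-∷-downTo r p (suc m) = refl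

suc-ones : ∀ m → suc (ones m) ≡ 2 ^ suc m
suc-ones zero    = refl
suc-ones (suc m) = trans (double (ones m)) (cong (2 *_) (suc-ones m))
  where double : ∀ o → suc (suc (o + o)) ≡ 2 * suc o
        double = solve-∀

2^[1+m+p]≡2^p*ones+2^p : ∀ p m → 2 ^ (suc m + p) ≡ 2 ^ p * ones m + 2 ^ p
2^[1+m+p]≡2^p*ones+2^p p m = begin
  2 ^ (suc m + p)              ≡⟨ ^-distribˡ-+-* 2 (suc m) p ⟩
  2 ^ suc m * 2 ^ p            ≡⟨ cong (_* 2 ^ p) (sym (suc-ones m)) ⟩
  suc (ones m) * 2 ^ p         ≡⟨ regroup (ones m) (2 ^ p) ⟩
  2 ^ p * ones m + 2 ^ p       ∎
  where
  open ≡-Reasoning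
  regroup : ∀ o a → suc o * a ≡ a * o + a
  regroup = solve-∀

leaves-downTo : ∀ p m → leaves (ladderDesc (downTo p m)) ≡ 2 ^ p * ones m
leaves-downTo p zero    = trans (leaves-perfect p) (sym (*-identityʳ (2 ^ p)))
leaves-downTo p (suc m) rewrite ladderDesc-∷-downTo (suc m + p) p m = begin
  leaves (perfect (suc m + p)) + leaves (ladderDesc (downTo p m)) ≡⟨ cong₂ _+_ (leaves-perfect (suc m + p)) (leaves-downTo p m) ⟩
  2 ^ (suc m + p) + 2 ^ p * ones m                                ≡⟨ cong (_+ 2 ^ p * ones m) (2^[1+m+p]≡2^p*ones+2^p p m) ⟩
  2 ^ p * ones m + 2 ^ p + 2 ^ p * ones m                         ≡⟨ regroup (2 ^ p) (ones m) ⟩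
  2 ^ p * ones (suc m)                                            ∎
  where
  open ≡-Reasoning
  regroup : ∀ a o → a * o + a + a * o ≡ a * suc (o + o)
  regroup = solve-∀

colless-downTo : ∀ p m → colless (ladderDesc (downTo p m)) ≡ 2 ^ p * m
colless-downTo p zero    = trans (colless-perfect p) (sym (*-zeroʳ (2 ^ p)))
colless-downTo p (suc m) rewrite ladderDesc-∷-downTo (suc m + p) p m = begin
  ∣ leaves (perfect (suc m + p)) - leaves (ladderDesc (downTo p m)) ∣ + colless (perfect (suc m + p)) + colless (ladderDesc (downTo p m))
    ≡⟨ cong₂ (λ a b → ∣ a - leaves (ladderDesc (downTo p m)) ∣ + b + colless (ladderDesc (downTo p m)))
             (trans (leaves-perfect (suc m + p)) (2^[1+m+p]≡2^p*ones+2^p p m)) (colless-perfect (suc m + p)) ⟩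
  ∣ 2 ^ p * ones m + 2 ^ p - leaves (ladderDesc (downTo p m)) ∣ + 0 + colless (ladderDesc (downTo p m))
    ≡⟨ cong₂ (λ l c → ∣ 2 ^ p * ones m + 2 ^ p - l ∣ + 0 + c) (leaves-downTo p m) (colless-downTo p m) ⟩
  ∣ 2 ^ p * ones m + 2 ^ p - 2 ^ p * ones m ∣ + 0 + 2 ^ p * m
    ≡⟨ cong (λ d → d + 0 + 2 ^ p * m) (trans (∣-∣-comm (2 ^ p * ones m + 2 ^ p) _) (∣m-m+n∣≡n (2 ^ p * ones m) (2 ^ p))) ⟩
  2 ^ p + 0 + 2 ^ p * m
    ≡⟨ trans (cong (_+ 2 ^ p * m) (+-identityʳ (2 ^ p))) (sym (*-suc (2 ^ p) m)) ⟩
  2 ^ p * suc m ∎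
  where open ≡-Reasoning

descMinD-2^*ones : ∀ p m → descMinD (2 ^ p * ones m) ≡ ladderDesc (downTo p m)
descMinD-2^*ones p m = cong ladderDesc (begin
  reverse (binExps (2 ^ p * ones m))   ≡⟨ cong reverse (digitsAux-2^*ones p _ 0 m ≤-refl) ⟩
  reverse (upFrom (p + 0) m)           ≡⟨ cong (λ q → reverse (upFrom q m)) (+-identityʳ p) ⟩
  reverse (upFrom p m)                 ≡⟨ reverse-upFrom p m ⟩
  downTo p m                           ∎)
  where open ≡-Reasoning

δ-ones : ∀ m → δ (ones m) ≡ m
δ-ones zero    = refl
δ-ones (suc m) = begin
  δ (suc (ones m + ones m))         ≡⟨ δ-double+1 (ones m) (ones>0 m) ⟩
  1 + δ (ones m) + δ (suc (ones m)) ≡⟨ cong₂ (λ a b → 1 + a + b) (δ-ones m) (trans (cong δ (suc-ones m)) (δ-2^ (suc m))) ⟩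
  1 + m + 0                         ≡⟨ +-identityʳ (suc m) ⟩
  suc m                             ∎
  where open ≡-Reasoning

cdesc-2^*ones : ∀ p m → cdesc (2 ^ p * ones m) ≡ 2 ^ p * m
cdesc-2^*ones p m = trans (cong colless (descMinD-2^*ones p m)) (colless-downTo p m)

CdescIsMin : ℕ → ℕ → Set
CdescIsMin n c = cdesc n ≡ c × IsMinColless n c

cdescIsMin-2^*ones : ∀ p m → CdescIsMin (2 ^ p * ones m) (2 ^ p * m)
cdescIsMin-2^*ones p m =
  cdesc-2^*ones p m ,
  (ladderDesc (downTo p m) , leaves-downTo p m , colless-downTo p m) ,
  λ t leaves≡ → subst (_≤ colless t) (trans (cong δ leaves≡) δ≡) (δ-≤-colless t)
  where
  δ≡ : δ (2 ^ p * ones m) ≡ 2 ^ p * m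
  δ≡ = trans (δ-2^* p (ones m)) (cong (2 ^ p *_) (δ-ones m))

-- Optimal descending ladders

IsOptimal : Tree → Set
IsOptimal t = ∀ u → leaves u ≡ leaves t → colless t ≤ colless u

optimal-right : ∀ {l r} → IsOptimal (node l r) → IsOptimal r
optimal-right {l} opt u u≡r with opt (node l u) (cong (leaves l +_) u≡r)
... | le rewrite u≡r = +-cancelˡ-≤ _ _ _ le

rebalance-leaves : ∀ q t → leaves (node (node (perfect q) t) (perfect q)) ≡ leaves (node (perfect (suc q)) t)
rebalance-leaves q t = swap (leaves (perfect q)) (leaves t)
  where swap : ∀ a l → a + l + a ≡ a + a + l
        swap = solve-∀

-- The left tree costs 2 ^ q + colless t, the right one 2 ^ (q + 1) ∸ leaves t + colless t.
rebalance-< : ∀ q t → leaves t < 2 ^ q →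
  colless (node (node (perfect q) t) (perfect q)) < colless (node (perfect (suc q)) t)
rebalance-< q t l<2^q with k , 1+l+k≡2^q ← m≤n⇒∃[o]m+o≡n l<2^q
  rewrite colless-perfect q | leaves-perfect q | ∣n-n∣≡0 (2 ^ q) | sym (trans (+-suc (leaves t) k) 1+l+k≡2^q) = begin-strict
  ∣ a + l - a ∣ + (∣ a - l ∣ + 0 + c) + 0         ≡⟨ cong₂ (λ x y → x + (y + 0 + c) + 0) (∣-∣-comm (a + l) a) (∣-∣-comm a l) ⟩
  ∣ a - a + l ∣ + (∣ l - l + suc k ∣ + 0 + c) + 0 ≡⟨ cong₂ (λ x y → x + (y + 0 + c) + 0) (∣m-m+n∣≡n a l) (∣m-m+n∣≡n l (suc k)) ⟩
  l + (suc k + 0 + c) + 0                         ≡⟨ regroup l (suc k) c ⟩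
  a + c                                           <⟨ +-monoˡ-< c (m<n+m a {suc k} (s≤s z≤n)) ⟩
  suc k + a + c                                   ≡⟨ cong (_+ c) (sym (∣m-m+n∣≡n l (suc k + a))) ⟩
  ∣ l - l + (suc k + a) ∣ + c                     ≡⟨ cong (λ x → ∣ l - x ∣ + c) (sym (+-assoc l (suc k) a)) ⟩
  ∣ l - a + a ∣ + c                               ≡⟨ cong (_+ c) (∣-∣-comm l (a + a)) ⟩
  ∣ a + a - l ∣ + c                               ≡⟨ cong (_+ c) (sym (+-identityʳ _)) ⟩
  ∣ a + a - l ∣ + 0 + c                           ∎
  where
  open ≤-Reasoning
  l = leaves t
  c = colless t
  a = l + suc k
  regroup : ∀ l k c → l + (k + 0 + c) + 0 ≡ l + k + c
  regroup = solve-∀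

binValue<2^[1+head] : ∀ r rs → Linked _>_ (r ∷ rs) → binValue (r ∷ rs) < 2 ^ suc r
binValue<2^[1+head] r [] _ = +-monoʳ-< (2 ^ r) (≤-trans (m^n>0 2 r) (m≤m+n (2 ^ r) 0))
binValue<2^[1+head] r (s ∷ rs) (s<r ∷ desc) = begin-strict
  2 ^ r + binValue (s ∷ rs)   <⟨ +-monoʳ-< (2 ^ r) (binValue<2^[1+head] s rs desc) ⟩
  2 ^ r + 2 ^ suc s           ≤⟨ +-monoʳ-≤ (2 ^ r) (^-monoʳ-≤ 2 s<r) ⟩
  2 ^ r + 2 ^ r               ≡⟨ cong (2 ^ r +_) (sym (+-identityʳ (2 ^ r))) ⟩
  2 ^ suc r                   ∎
  where open ≤-Reasoning

head-downTo : ∀ {s rs p m} → s ∷ rs ≡ downTo p m → s ≡ m + p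
head-downTo {m = zero}  refl = refl
head-downTo {m = suc m} refl = refl

optimal-ladder⇒downTo : ∀ r rs → Linked _>_ (r ∷ rs) → IsOptimal (ladderDesc (r ∷ rs)) →
  ∃₂ λ p m → r ∷ rs ≡ downTo p m
optimal-ladder⇒downTo r [] _ _ = r , 0 , refl
optimal-ladder⇒downTo r (s ∷ rs) (s<r ∷ desc) opt
  with p , m , s∷rs≡ ← optimal-ladder⇒downTo s rs desc (optimal-right {perfect r} {ladderDesc (s ∷ rs)} opt)
  with m≤n⇒m<n∨m≡n s<r
... | inj₂ refl = p , suc m , cong₂ _∷_ (cong suc (head-downTo s∷rs≡)) s∷rs≡
... | inj₁ (s≤s {n = q} 1+s≤q) =
  contradiction (opt (node (node (perfect q) T) (perfect q)) (rebalance-leaves q T))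
                (<⇒≱ (rebalance-< q T (<-≤-trans T<2^[1+s] (^-monoʳ-≤ 2 1+s≤q))))
  where
  T = ladderDesc (s ∷ rs)
  T<2^[1+s] : leaves T < 2 ^ suc s
  T<2^[1+s] = subst (_< 2 ^ suc s) (sym (leaves-ladderDesc (s ∷ rs) (≤-trans (m^n>0 2 s) (m≤m+n _ _))))
                    (binValue<2^[1+head] s rs desc)

optimal-descending⇒2^*ones : ∀ ds → Linked _>_ ds → 1 ≤ binValue ds → IsOptimal (ladderDesc ds) →
  ∃₂ λ p m → binValue ds ≡ 2 ^ p * ones m
optimal-descending⇒2^*ones (r ∷ rs) desc pos opt with p , m , r∷rs≡ ← optimal-ladder⇒downTo r rs desc opt =
  p , m , (begin
    binValue (r ∷ rs)                 ≡⟨ sym (leaves-ladderDesc (r ∷ rs) pos) ⟩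
    leaves (ladderDesc (r ∷ rs))      ≡⟨ cong (leaves ∘ ladderDesc) r∷rs≡ ⟩
    leaves (ladderDesc (downTo p m))  ≡⟨ leaves-downTo p m ⟩
    2 ^ p * ones m                    ∎)
  where open ≡-Reasoning

minimal⇒2^*ones : ∀ {n} → 1 ≤ n → IsMinColless n (cdesc n) → ∃₂ λ p m → n ≡ 2 ^ p * ones m
minimal⇒2^*ones {n} 1≤n (_ , minimal) =
  subst (λ v → ∃₂ λ p m → v ≡ 2 ^ p * ones m) binValue≡n
    (optimal-descending⇒2^*ones ds (Linked-reverse (digitsAux-ascending n 0 n)) 1≤binValue optimal)
  where
  ds = reverse (binExps n)
  binValue≡n : binValue ds ≡ n
  binValue≡n = trans (binValue-reverse (binExps n)) (binValue-binExps n)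
  1≤binValue : 1 ≤ binValue ds
  1≤binValue = subst (1 ≤_) (sym binValue≡n) 1≤n
  optimal : IsOptimal (descMinD n)
  optimal u u≡ = minimal u (trans u≡ (trans (leaves-ladderDesc ds 1≤binValue) binValue≡n))

minimal⇔2^*ones : ∀ {n} → 1 ≤ n → IsMinColless n (cdesc n) ⇔ (∃₂ λ p m → n ≡ 2 ^ p * ones m)
minimal⇔2^*ones 1≤n = mk⇔ (minimal⇒2^*ones 1≤n) λ where
  (p , m , refl) → let (cdesc≡ , isMin) = cdescIsMin-2^*ones p m in subst (IsMinColless _) (sym cdesc≡) isMin

2^[j+m+1]∸2^j≡2^j*ones : ∀ j m → 2 ^ (j + m + 1) ∸ 2 ^ j ≡ 2 ^ j * ones m
2^[j+m+1]∸2^j≡2^j*ones j m = begin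
  2 ^ (j + m + 1) ∸ 2 ^ j         ≡⟨ cong (λ e → 2 ^ e ∸ 2 ^ j) (shape j m) ⟩
  2 ^ (suc m + j) ∸ 2 ^ j         ≡⟨ cong (_∸ 2 ^ j) (2^[1+m+p]≡2^p*ones+2^p j m) ⟩
  2 ^ j * ones m + 2 ^ j ∸ 2 ^ j  ≡⟨ m+n∸n≡m _ (2 ^ j) ⟩
  2 ^ j * ones m                  ∎
  where
  open ≡-Reasoning
  shape : ∀ j m → j + m + 1 ≡ suc m + j
  shape = solve-∀

PowerOrDifferenceOfPowers : ℕ → Set
PowerOrDifferenceOfPowers n =
  Σ ℕ (λ k → n ≡ 2 ^ k) ⊎ Σ ℕ (λ k → Σ ℕ (λ j → j ≤ k × n ≡ 2 ^ (k + 1) ∸ 2 ^ j))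

2^*ones⇔powerOrDifferenceOfPowers : ∀ {n} → (∃₂ λ p m → n ≡ 2 ^ p * ones m) ⇔ PowerOrDifferenceOfPowers n
2^*ones⇔powerOrDifferenceOfPowers = mk⇔ to from
  where
  to : ∀ {n} → (∃₂ λ p m → n ≡ 2 ^ p * ones m) → PowerOrDifferenceOfPowers n
  to (p , m , refl) = inj₂ (p + m , p , m≤m+n p m , sym (2^[j+m+1]∸2^j≡2^j*ones p m))
  from : ∀ {n} → PowerOrDifferenceOfPowers n → ∃₂ λ p m → n ≡ 2 ^ p * ones m
  from (inj₁ (k , refl)) = k , 0 , sym (*-identityʳ (2 ^ k))
  from (inj₂ (k , j , j≤k , refl)) with m , refl ← m≤n⇒∃[o]m+o≡n j≤k = j , m , 2^[j+m+1]∸2^j≡2^j*ones j m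

cdescIsMin-2^ : ∀ k → CdescIsMin (2 ^ k) 0
cdescIsMin-2^ k = subst₂ CdescIsMin (*-identityʳ (2 ^ k)) (*-zeroʳ (2 ^ k)) (cdescIsMin-2^*ones k 0)

cdescIsMin-2^[k+1]∸2^j : ∀ k j → j ≤ k → CdescIsMin (2 ^ (k + 1) ∸ 2 ^ j) (2 ^ j * (k ∸ j))
cdescIsMin-2^[k+1]∸2^j k j j≤k with m , refl ← m≤n⇒∃[o]m+o≡n j≤k =
  subst₂ CdescIsMin (sym (2^[j+m+1]∸2^j≡2^j*ones j m)) (cong (2 ^ j *_) (sym (m+n∸m≡n j m)))
         (cdescIsMin-2^*ones j m)

corollary97 :
    ((n : ℕ) → 1 ≤ n →
      (IsMinColless n (cdesc n) ⇔
        (Σ ℕ (λ k → n ≡ 2 ^ k) ⊎ Σ ℕ (λ k → Σ ℕ (λ j → j ≤ k × n ≡ 2 ^ (k + 1) ∸ 2 ^ j)))))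
    × ((k : ℕ) → cdesc (2 ^ k) ≡ 0 × IsMinColless (2 ^ k) 0)
    × ((k j : ℕ) → j ≤ k →
        cdesc (2 ^ (k + 1) ∸ 2 ^ j) ≡ 2 ^ j * (k ∸ j)
        × IsMinColless (2 ^ (k + 1) ∸ 2 ^ j) (2 ^ j * (k ∸ j)))
corollary97 =
  (λ n 1≤n → 2^*ones⇔powerOrDifferenceOfPowers ⇔-∘ minimal⇔2^*ones 1≤n) ,
  cdescIsMin-2^ ,
  cdescIsMin-2^[k+1]∸2^j
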